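{- Let $\mathbf A$ be a GMTL-algebra or an MTL-algebra, and let $\mathfrak a,\mathfrak b$ be nonempty lattice filters of $\mathbf A$. If either one of $\mathfrak a$ or $\mathfrak b$ is prime, then either $\mathfrak a\bullet\mathfrak b$ is prime or $\mathfrak a\bullet\mathfrak b=A$.
   Context: **Algebras.** - A GMTL-algebra is a commutative integral residuated lattice $(A,\wedge,\vee,\cdot,\to,1)$ with distributive lattice reduct satisfying $(a\to b)\vee(b\to a)=1$. Here $1$ is the top, and $a\cdot b\le c\iff b\le a\to c$. - An MTL-algebra is a GMTL-algebra with an added constant $0$ for the least element. **Filters.** - $\mathfrak a\bullet\mathfrak b=\{c\in A:\exists a\in\mathfrak a,\ b\in\mathfrak b,\ a\cdot b\le c\}$. - A prime filter is a proper lattice filter $F$ such that $a\vee b\in F$ implies $a\in F$ or $b\in F$. -}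

module Defs where

open import Level using (Level; suc)
open import Data.Product using (Σ; ∃; _×_; _,_)
open import Data.Sum using (_⊎_)
open import Relation.Nullary using (¬_)
open import Relation.Unary using (Pred; _∈_; _∉_)
open import Relation.Binary.PropositionalEquality using (_≡_)
open import Function.Bundles using (_⇔_)
open import Algebra.Core using (Op₂)
open import Algebra.Structures using (IsCommutativeMonoid)
open import Algebra.Lattice.Structures using (IsDistributiveLattice)

record GMTLAlgebra (c : Level) : Set (suc c) where
  infixr 7 _·_
  infixr 6 _∧_
  infixr 5 _∨_
  infixr 4 _⇒_
  infix  3 _≤_
  field
    Carrier : Set c
    _∧_ _∨_ _·_ _⇒_ : Op₂ Carrier
    1#      : Carrier
  _≤_ : Carrier → Carrier → Set c
  a ≤ b = a ∧ b ≡ a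
  field
    isDistributiveLattice : IsDistributiveLattice _≡_ _∨_ _∧_
    ·-isCommutativeMonoid : IsCommutativeMonoid _≡_ _·_ 1#
    1-top       : ∀ a → a ≤ 1#
    residuation : ∀ a b c → (a · b ≤ c) ⇔ (b ≤ (a ⇒ c))
    prelinearity : ∀ a b → ((a ⇒ b) ∨ (b ⇒ a)) ≡ 1#

record MTLAlgebra (c : Level) : Set (suc c) where
  field
    gmtl : GMTLAlgebra c
  open GMTLAlgebra gmtl
  field
    0#     : Carrier
    0-bottom : ∀ a → 0# ≤ a

module _ {c : Level} (A : GMTLAlgebra c) where
  open GMTLAlgebra A

  record IsLatticeFilter (F : Pred Carrier c) : Set c where
    field
      upward : ∀ {a b} → a ∈ F → a ≤ b → b ∈ F
      meet   : ∀ {a b} → a ∈ F → b ∈ F → (a ∧ b) ∈ F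

  Nonempty : Pred Carrier c → Set c
  Nonempty F = ∃ λ a → a ∈ F

  Proper : Pred Carrier c → Set c
  Proper F = ∃ λ a → a ∉ F

  record IsPrime (F : Pred Carrier c) : Set c where
    field
      isLatticeFilter : IsLatticeFilter F
      proper          : Proper F
      prime           : ∀ {a b} → (a ∨ b) ∈ F → a ∈ F ⊎ b ∈ F

  _•_ : Pred Carrier c → Pred Carrier c → Pred Carrier c
  (𝔞 • 𝔟) x = ∃ λ a → ∃ λ b → a ∈ 𝔞 × b ∈ 𝔟 × (a · b) ≤ x

  IsWhole : Pred Carrier c → Set c
  IsWhole F = ∀ x → x ∈ F

Lemma3p9For : ∀ {c} → GMTLAlgebra c → Set (suc c)
Lemma3p9For {c} A = (𝔞 𝔟 : Pred Carrier c) →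
    IsLatticeFilter A 𝔞 → Nonempty A 𝔞 →
    IsLatticeFilter A 𝔟 → Nonempty A 𝔟 →
    (IsPrime A 𝔞 ⊎ IsPrime A 𝔟) →
    IsPrime A (_•_ A 𝔞 𝔟) ⊎ IsWhole A (_•_ A 𝔞 𝔟)
  where open GMTLAlgebra A

-- Prelinearity gives a = a · ((x ⇒ y) ∨ (y ⇒ x)) ≤ a · (x ⇒ y) ∨ a · (y ⇒ x) for every a.
-- If a ∈ 𝔞 with 𝔞 prime and a · b ≤ x ∨ y with b ∈ 𝔟, then one of a · (x ⇒ y), a · (y ⇒ x)
-- lies in 𝔞, and since (x ∨ y) · (x ⇒ y) ≤ y its product with b lies below y (resp. x).
-- So 𝔞 • 𝔟 is join-prime; it is always a lattice filter, and classically it is either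
-- proper, hence prime, or all of A.
module Submission where

open import Defs
open import Level using (Level)
open import Data.Product using (_×_; _,_)
open import Data.Sum using (_⊎_; inj₁; inj₂; map)
open import Axiom.ExcludedMiddle using (ExcludedMiddle)
open import Axiom.DoubleNegationElimination using (em⇒dne)
open import Relation.Nullary using (yes; no)
open import Relation.Nullary.Negation using (¬∃⟶∀¬)
open import Relation.Unary using (Pred; _∈_; _⊆_)
open import Relation.Binary.PropositionalEquality
open import Function.Bundles using (Equivalence)
open import Algebra.Core using (Op₂)
open import Algebra.Lattice.Bundles using (Lattice)
open import Algebra.Lattice.Structures using (IsLattice; IsDistributiveLattice)
open import Algebra.Structures using (IsCommutativeMonoid)
import Algebra.Lattice.Properties.Lattice as LatticeProperties
import Relation.Binary.Lattice.Bundles as OrderTheoretic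

module MeetOrder {a : Level} {A : Set a} {_∨_ _∧_ : Op₂ A}
                 (isLattice : IsLattice _≡_ _∨_ _∧_) where

  private
    lattice : Lattice a a
    lattice = record { isLattice = isLattice }

    open LatticeProperties lattice using (∧-idem; ∨-∧-orderTheoreticLattice)
    module O = OrderTheoretic.Lattice ∨-∧-orderTheoreticLattice

  infix 4 _≤_

  _≤_ : A → A → Set a
  x ≤ y = x ∧ y ≡ x

  ≤-refl : ∀ x → x ≤ x
  ≤-refl = ∧-idem

  ≤-trans : ∀ {x y z} → x ≤ y → y ≤ z → x ≤ z
  ≤-trans p q = sym (O.trans (sym p) (sym q))

  x≤x∨y : ∀ x y → x ≤ x ∨ y
  x≤x∨y x y = sym (O.x≤x∨y x y)

  y≤x∨y : ∀ x y → y ≤ x ∨ y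
  y≤x∨y x y = sym (O.y≤x∨y x y)

  ∨-least : ∀ {x y z} → x ≤ z → y ≤ z → x ∨ y ≤ z
  ∨-least p q = sym (O.∨-least (sym p) (sym q))

  x∧y≤x : ∀ x y → x ∧ y ≤ x
  x∧y≤x x y = sym (O.x∧y≤x x y)

  x∧y≤y : ∀ x y → x ∧ y ≤ y
  x∧y≤y x y = sym (O.x∧y≤y x y)

  ∧-greatest : ∀ {x y z} → x ≤ y → x ≤ z → x ≤ y ∧ z
  ∧-greatest p q = sym (O.∧-greatest (sym p) (sym q))

module GMTLProperties {c : Level} (A : GMTLAlgebra c) where
  open GMTLAlgebra A
  open IsDistributiveLattice isDistributiveLattice using (isLattice)
  open IsCommutativeMonoid ·-isCommutativeMonoid
    using () renaming (comm to ·-comm; assoc to ·-assoc; identityˡ to ·-identityˡ; identityʳ to ·-identityʳ)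
  open MeetOrder isLattice public hiding (_≤_)

  residualʳ : ∀ {x y z} → x · y ≤ z → y ≤ x ⇒ z
  residualʳ {x} {y} {z} = Equivalence.to (residuation x y z)

  residualˡ : ∀ {x y z} → y ≤ x ⇒ z → x · y ≤ z
  residualˡ {x} {y} {z} = Equivalence.from (residuation x y z)

  ·-monoʳ-≤ : ∀ z {x y} → x ≤ y → z · x ≤ z · y
  ·-monoʳ-≤ z {y = y} x≤y = residualˡ (≤-trans x≤y (residualʳ (≤-refl (z · y))))

  ·-monoˡ-≤ : ∀ z {x y} → x ≤ y → x · z ≤ y · z
  ·-monoˡ-≤ z {x} {y} x≤y = subst₂ _≤_ (·-comm z x) (·-comm z y) (·-monoʳ-≤ z x≤y)

  ·-mono-≤ : ∀ {x x′ y y′} → x ≤ x′ → y ≤ y′ → x · y ≤ x′ · y′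
  ·-mono-≤ {x′ = x′} {y} p q = ≤-trans (·-monoˡ-≤ y p) (·-monoʳ-≤ x′ q)

  x·y≤y : ∀ x y → x · y ≤ y
  x·y≤y x y = subst (x · y ≤_) (·-identityˡ y) (·-monoˡ-≤ y (1-top x))

  x·[y∨z]≤x·y∨x·z : ∀ x y z → x · (y ∨ z) ≤ x · y ∨ x · z
  x·[y∨z]≤x·y∨x·z x y z =
    residualˡ (∨-least (residualʳ (x≤x∨y (x · y) (x · z))) (residualʳ (y≤x∨y (x · y) (x · z))))

  x≤x·[y⇒z]∨x·[z⇒y] : ∀ x y z → x ≤ x · (y ⇒ z) ∨ x · (z ⇒ y)
  x≤x·[y⇒z]∨x·[z⇒y] x y z =
    subst (_≤ x · (y ⇒ z) ∨ x · (z ⇒ y))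
          (trans (cong (x ·_) (prelinearity y z)) (·-identityʳ x))
          (x·[y∨z]≤x·y∨x·z x (y ⇒ z) (z ⇒ y))

  [x∨y]·[x⇒y]≤y : ∀ x y → (x ∨ y) · (x ⇒ y) ≤ y
  [x∨y]·[x⇒y]≤y x y = subst (_≤ y) (·-comm (x ⇒ y) (x ∨ y)) (residualˡ (∨-least x≤[x⇒y]⇒y y≤[x⇒y]⇒y))
    where
      x≤[x⇒y]⇒y : x ≤ (x ⇒ y) ⇒ y
      x≤[x⇒y]⇒y = residualʳ (subst (_≤ y) (·-comm x (x ⇒ y)) (residualˡ (≤-refl (x ⇒ y))))
      y≤[x⇒y]⇒y : y ≤ (x ⇒ y) ⇒ y
      y≤[x⇒y]⇒y = residualʳ (x·y≤y (x ⇒ y) y)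

  ·-cut-∨ : ∀ {u v x y} → u · v ≤ x ∨ y → (u · (x ⇒ y)) · v ≤ y
  ·-cut-∨ {u} {v} {x} {y} uv≤x∨y =
    subst (_≤ y) (sym reassoc) (≤-trans (·-monoˡ-≤ (x ⇒ y) uv≤x∨y) ([x∨y]·[x⇒y]≤y x y))
    where
      open ≡-Reasoning
      reassoc : (u · (x ⇒ y)) · v ≡ (u · v) · (x ⇒ y)
      reassoc = begin
        (u · (x ⇒ y)) · v ≡⟨ ·-assoc u (x ⇒ y) v ⟩
        u · ((x ⇒ y) · v) ≡⟨ cong (u ·_) (·-comm (x ⇒ y) v) ⟩
        u · (v · (x ⇒ y)) ≡⟨ sym (·-assoc u v (x ⇒ y)) ⟩
        (u · v) · (x ⇒ y) ∎

module FilterProduct {c : Level} (A : GMTLAlgebra c) where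
  open GMTLAlgebra A
  open GMTLProperties A
  open IsDistributiveLattice isDistributiveLattice using (∨-comm)
  open IsCommutativeMonoid ·-isCommutativeMonoid using () renaming (comm to ·-comm)

  private
    _⊙_ : Pred Carrier c → Pred Carrier c → Pred Carrier c
    _⊙_ = _•_ A

  •-comm : ∀ 𝔞 𝔟 → 𝔟 ⊙ 𝔞 ⊆ 𝔞 ⊙ 𝔟
  •-comm 𝔞 𝔟 (b , a , b∈𝔟 , a∈𝔞 , b·a≤x) = a , b , a∈𝔞 , b∈𝔟 , subst (_≤ _) (·-comm b a) b·a≤x

  •-isLatticeFilter : ∀ {𝔞 𝔟} → IsLatticeFilter A 𝔞 → IsLatticeFilter A 𝔟 → IsLatticeFilter A (𝔞 ⊙ 𝔟)
  •-isLatticeFilter {𝔞} {𝔟} 𝔞-filter 𝔟-filter = record { upward = upward ; meet = meet }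
    where
      upward : ∀ {x y} → x ∈ 𝔞 ⊙ 𝔟 → x ≤ y → y ∈ 𝔞 ⊙ 𝔟
      upward (a , b , a∈𝔞 , b∈𝔟 , a·b≤x) x≤y = a , b , a∈𝔞 , b∈𝔟 , ≤-trans a·b≤x x≤y
      meet : ∀ {x y} → x ∈ 𝔞 ⊙ 𝔟 → y ∈ 𝔞 ⊙ 𝔟 → (x ∧ y) ∈ 𝔞 ⊙ 𝔟
      meet (a , b , a∈𝔞 , b∈𝔟 , a·b≤x) (a′ , b′ , a′∈𝔞 , b′∈𝔟 , a′·b′≤y) =
        a ∧ a′ , b ∧ b′ ,
        IsLatticeFilter.meet 𝔞-filter a∈𝔞 a′∈𝔞 , IsLatticeFilter.meet 𝔟-filter b∈𝔟 b′∈𝔟 ,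
        ∧-greatest (≤-trans (·-mono-≤ (x∧y≤x a a′) (x∧y≤x b b′)) a·b≤x)
                   (≤-trans (·-mono-≤ (x∧y≤y a a′) (x∧y≤y b b′)) a′·b′≤y)

  JoinPrime : Pred Carrier c → Set c
  JoinPrime F = ∀ {x y} → (x ∨ y) ∈ F → x ∈ F ⊎ y ∈ F

  •-joinPrimeˡ : ∀ {𝔞} 𝔟 → IsPrime A 𝔞 → JoinPrime (𝔞 ⊙ 𝔟)
  •-joinPrimeˡ {𝔞} 𝔟 𝔞-prime {x} {y} (a , b , a∈𝔞 , b∈𝔟 , a·b≤x∨y)
    with IsPrime.prime 𝔞-prime
           (IsLatticeFilter.upward (IsPrime.isLatticeFilter 𝔞-prime) a∈𝔞 (x≤x·[y⇒z]∨x·[z⇒y] a x y))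
  ... | inj₁ a·[x⇒y]∈𝔞 = inj₂ (a · (x ⇒ y) , b , a·[x⇒y]∈𝔞 , b∈𝔟 , ·-cut-∨ a·b≤x∨y)
  ... | inj₂ a·[y⇒x]∈𝔞 =
    inj₁ (a · (y ⇒ x) , b , a·[y⇒x]∈𝔞 , b∈𝔟 , ·-cut-∨ (subst (a · b ≤_) (∨-comm x y) a·b≤x∨y))

  •-joinPrimeʳ : ∀ 𝔞 {𝔟} → IsPrime A 𝔟 → JoinPrime (𝔞 ⊙ 𝔟)
  •-joinPrimeʳ 𝔞 {𝔟} 𝔟-prime x∨y∈𝔞𝔟 =
    map (•-comm 𝔞 𝔟) (•-comm 𝔞 𝔟) (•-joinPrimeˡ 𝔞 𝔟-prime (•-comm 𝔟 𝔞 x∨y∈𝔞𝔟))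

  proper⊎whole : ExcludedMiddle c → ∀ F → Proper A F ⊎ IsWhole A F
  proper⊎whole em F with em {Proper A F}
  ... | yes F-proper = inj₁ F-proper
  ... | no F-improper = inj₂ λ x → em⇒dne em (¬∃⟶∀¬ F-improper x)

  •-prime⊎whole : ExcludedMiddle c → Lemma3p9For A
  •-prime⊎whole em 𝔞 𝔟 𝔞-filter _ 𝔟-filter _ one-prime with proper⊎whole em (𝔞 ⊙ 𝔟)
  ... | inj₂ whole = inj₂ whole
  ... | inj₁ proper = inj₁ (record
    { isLatticeFilter = •-isLatticeFilter 𝔞-filter 𝔟-filter
    ; proper = proper
    ; prime = joinPrime one-prime
    })
    where
      joinPrime : IsPrime A 𝔞 ⊎ IsPrime A 𝔟 → JoinPrime (𝔞 ⊙ 𝔟)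
      joinPrime (inj₁ 𝔞-prime) = •-joinPrimeˡ 𝔟 𝔞-prime
      joinPrime (inj₂ 𝔟-prime) = •-joinPrimeʳ 𝔞 𝔟-prime

lemma3p9 : {c : Level} → ExcludedMiddle c →
    ((A : GMTLAlgebra c) → Lemma3p9For A) × ((A : MTLAlgebra c) → Lemma3p9For (MTLAlgebra.gmtl A))
lemma3p9 em = (λ A → FilterProduct.•-prime⊎whole A em) , (λ A → FilterProduct.•-prime⊎whole (MTLAlgebra.gmtl A) em)
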